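{- In the setting described in the context (with $U_0$ a recurrent state and $v_1$ following an anti-threshold rule), let $x\in\{+1,-1\}$ and $t\ge0$. If $(c_{t+1},c_{t+2},c_{t+3})=(-x,x,x)$, then $U^*_t\subseteq U^*_{t+4}$ if $x=+1$, and $U^*_t\supseteq U^*_{t+4}$ if $x=-1$.
   Context: $G$ is a finite graph (loops allowed, no multiple edges) on vertex set $\{v_1,\dots,v_n\}$; $N_i$ is the neighbourhood of $v_i$ (including $v_i$ iff there is a loop at $v_i$). Each vertex holds an opinion in $\{+1,-1\}$; $U_t$ is the set of vertices with opinion $+1$ at time $t$. All vertices update simultaneously: $v_i\in U_{t+1}$ iff $N_i\cap U_t\in\mathcal S_i$, where for $i\ge2$, $\mathcal S_i=\{A\subseteq N_i:|A|\ge r_i\}$ (threshold rule, integer $r_i$), and $v_1$ follows an anti-threshold rule: $\mathcal S_1=\{A\subseteq N_1:|A|<r_1\}$ for some integer $r_1$. The initial state is recurrent: $U_p=U_0$ for some $p\ge1$. $c_t\in\{+1,-1\}$ denotes the opinion of $v_1$ at time $t$, and $U^*_t=U_t\setminus\{v_1\}$. -}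

module Defs where

open import Data.Nat using (ℕ; suc)
open import Data.Bool using (Bool; true; false; not)
open import Data.Fin using (Fin; zero; suc)
open import Data.Fin.Subset using (Subset; _∈_; _∩_; ∣_∣)
open import Data.Vec using (lookup; tail)
open import Data.Integer using (ℤ; +_; _≤_; _<_)
open import Data.Product using (_×_)
open import Relation.Nullary using (¬_)
open import Function.Bundles using (_⇔_)

-- A finite graph on vertices Fin (suc n); vertex v₁ is 'zero'.
-- N i is the neighbourhood of i (contains i iff there is a loop at i).
-- Undirected: adjacency is symmetric.
Symmetric : {m : ℕ} → (Fin m → Subset m) → Set
Symmetric {m} N = (i j : Fin m) → j ∈ N i → i ∈ N j

RuleHolds : {n : ℕ} → (N : Fin (suc n) → Subset (suc n)) → (r : Fin (suc n) → ℤ)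
          → Subset (suc n) → Fin (suc n) → Set
RuleHolds N r U zero    = + ∣ N zero ∩ U ∣ < r zero
RuleHolds N r U (suc i) = r (suc i) ≤ + ∣ N (suc i) ∩ U ∣

-- A trajectory U : ℕ → Subset (suc n) (U t = set of vertices with opinion +1)
-- evolving by simultaneous updates.
IsTrajectory : {n : ℕ} → (N : Fin (suc n) → Subset (suc n)) → (r : Fin (suc n) → ℤ)
             → (ℕ → Subset (suc n)) → Set
IsTrajectory {n} N r U =
  (t : ℕ) (i : Fin (suc n)) → (i ∈ U (suc t)) ⇔ RuleHolds N r (U t) i

-- Opinion of v₁ at time t: true = +1, false = −1.
c : {n : ℕ} → (ℕ → Subset (suc n)) → ℕ → Bool
c U t = lookup (U t) zero

-- U*_t = U_t \ {v₁}, as a subset of the remaining vertices v₂,…,v_{n+1}.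
U* : {n : ℕ} → (ℕ → Subset (suc n)) → ℕ → Subset n
U* U t = tail (U t)

-- For these vertices, Goles' Lyapunov functional of two
-- consecutive states, E(s) = Σᵢ 2 yᵢ(s+1) gᵢ(s) + Kᵢ (yᵢ(s) + yᵢ(s+1)), where gᵢ is the inflow from
-- the other threshold vertices and Kᵢ = bᵢ + 1 − 2 rᵢ with bᵢ = [v₁ ∈ Nᵢ], increases from s to s+1
-- by a sum of nonnegative vertex terms. A recurrent trajectory is periodic, so E is constant and
-- every term vanishes; a vanishing term with yᵢ(s+2) ≠ yᵢ(s) forces vᵢ to be adjacent to v₁ and
-- critical, rᵢ = 1 + gᵢ(s+1), so that yᵢ(s+2) = c_{s+1}: over two steps opinions only move
-- towards c_{s+1}. For x = +1, a vertex of U*_t either is still in U*_{t+2} ⊆ U*_{t+4}, or it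
-- left at t+2 and was critical at t+1; then gᵢ(t+3) ≥ gᵢ(t+1) and c_{t+3} = +1 bring it back over
-- its threshold at t+4. The case x = −1 is symmetric.

module Submission where

open import Data.Bool using (Bool; true; false; not; _≟_)
open import Data.Empty using (⊥-elim)
open import Data.Fin using (Fin; zero; suc; punchIn)
open import Data.Fin.Subset using (Subset; _∩_; ∣_∣; _⊆_; _⊇_)
open import Data.Fin.Subset.Properties using (⊆-antisym)
open import Data.Integer using (ℤ)
open import Data.Nat using (ℕ; zero; suc; z≤n; _≥_)
import Data.Nat as ℕ
import Data.Nat.Properties as ℕ
open import Data.Product using (Σ; _×_; _,_; proj₁; proj₂)
open import Data.Sum using (inj₁; inj₂)
open import Data.Vec using (_∷_; []; lookup; tail)
open import Data.Vec.Functional using (Vector)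
open import Data.Vec.Properties using ([]=⇒lookup; lookup⇒[]=)
open import Function using (_∘_)
open import Function.Bundles using (Equivalence)
open import Relation.Binary.Bundles using (Poset)
open import Relation.Binary.PropositionalEquality
open import Relation.Nullary using (¬_; yes; no; contradiction)

open import Defs

module _ {a ℓ₁ ℓ₂} (P : Poset a ℓ₁ ℓ₂) where
  open Poset P using (Carrier; _≈_; _≤_; antisym; ≤-respʳ-≈) renaming (refl to ≤-refl; trans to ≤-trans)

  increasing⇒≤-shift : (f : ℕ → Carrier) → (∀ t → f t ≤ f (suc t)) → ∀ k t → f t ≤ f (k ℕ.+ t)
  increasing⇒≤-shift f inc zero    t = ≤-refl
  increasing⇒≤-shift f inc (suc k) t = ≤-trans (increasing⇒≤-shift f inc k t) (inc (k ℕ.+ t))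

  increasing∧periodic⇒stationary : (f : ℕ → Carrier) (p : ℕ) → (∀ t → f t ≤ f (suc t)) →
                                    (∀ t → f (suc p ℕ.+ t) ≈ f t) → ∀ t → f (suc t) ≈ f t
  increasing∧periodic⇒stationary f p inc per t = antisym f[1+t]≤f[t] (inc t)
    where
    f[1+t]≤f[t] : f (suc t) ≤ f t
    f[1+t]≤f[t] = ≤-respʳ-≈ (per t)
      (subst (λ k → f (suc t) ≤ f k) (ℕ.+-suc p t) (increasing⇒≤-shift f inc p (suc t)))

module EnergyMethod where

  open import Data.Integer using (ℤ; nonNegative; +_; 0ℤ; 1ℤ; -1ℤ; -_; _+_; _*_; _-_; _≤_; +≤+)
  open import Data.Integer.Properties hiding (_≟_)
  open import Data.Integer.Tactic.RingSolver using (solve-∀)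
  open import Algebra.Properties.Semiring.Sum +-*-semiring

  ∑-mono-≤ : ∀ {n} {f g : Vector ℤ n} → (∀ i → f i ≤ g i) → sum f ≤ sum g
  ∑-mono-≤ {zero}  f≤g = ≤-refl
  ∑-mono-≤ {suc n} f≤g = +-mono-≤ (f≤g zero) (∑-mono-≤ (f≤g ∘ suc))

  ∑-nonneg : ∀ {n} {f : Vector ℤ n} → (∀ i → 0ℤ ≤ f i) → 0ℤ ≤ sum f
  ∑-nonneg {n} {f} 0≤f = subst (_≤ sum f) (sum-replicate-zero n) (∑-mono-≤ 0≤f)

  nonneg+nonneg≡0⇒≡0 : ∀ {i j} → 0ℤ ≤ i → 0ℤ ≤ j → i + j ≡ 0ℤ → i ≡ 0ℤ
  nonneg+nonneg≡0⇒≡0 {i} {j} 0≤i 0≤j i+j≡0 = ≤-antisym i≤0 0≤i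
    where
    i≤0 : i ≤ 0ℤ
    i≤0 = ≤-trans (i≤i+j i j {{nonNegative 0≤j}}) (≤-reflexive i+j≡0)

  ∑-nonneg≡0⇒≡0 : ∀ {n} {f : Vector ℤ n} → (∀ i → 0ℤ ≤ f i) → sum f ≡ 0ℤ → ∀ i → f i ≡ 0ℤ
  ∑-nonneg≡0⇒≡0 {suc n} {f} 0≤f ∑f≡0 i =
    nonneg+nonneg≡0⇒≡0 (0≤f i) (∑-nonneg (0≤f ∘ punchIn i)) (trans (sym (sum-remove f)) ∑f≡0)

  ∑-distrib-minus : ∀ {n} (f g : Vector ℤ n) → ∑[ i < n ] (f i - g i) ≡ sum f - sum g
  ∑-distrib-minus f g = begin
    sum (λ i → f i + - g i)         ≡⟨ ∑-distrib-+ f (-_ ∘ g) ⟩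
    sum f + sum (λ i → - g i)       ≡⟨ cong (λ s → sum f + s) (sum-cong-≗ (λ i → sym (-1*i≡-i (g i)))) ⟩
    sum f + sum (λ i → -1ℤ * g i)   ≡⟨ cong (λ s → sum f + s) (sym (*-distribˡ-sum -1ℤ g)) ⟩
    sum f + -1ℤ * sum g             ≡⟨ cong (λ s → sum f + s) (-1*i≡-i (sum g)) ⟩
    sum f - sum g                   ∎
    where open ≡-Reasoning

  module Energy {n : ℕ} (a : Fin n → Fin n → ℤ) where

    localField : Vector ℤ n → Vector ℤ n
    localField x i = ∑[ j < n ] (a i j * x j)

    energy : (K x y : Vector ℤ n) → ℤ
    energy K x y = ∑[ i < n ] (+ 2 * (y i * localField x i) + K i * (x i + y i))

    module _ (a-sym : ∀ i j → a i j ≡ a j i) where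

      localField-sym : ∀ x y → ∑[ i < n ] (x i * localField y i) ≡ ∑[ i < n ] (y i * localField x i)
      localField-sym x y = begin
        ∑[ i < n ] (x i * localField y i)
          ≡⟨ sum-cong-≗ (λ i → *-distribˡ-sum (x i) (λ j → a i j * y j)) ⟩
        ∑[ i < n ] ∑[ j < n ] (x i * (a i j * y j))
          ≡⟨ ∑-comm (λ i j → x i * (a i j * y j)) ⟩
        ∑[ j < n ] ∑[ i < n ] (x i * (a i j * y j))
          ≡⟨ sum-cong-≗ (λ j → sum-cong-≗ (λ i → transpose (x i) (y j) (a-sym i j))) ⟩
        ∑[ j < n ] ∑[ i < n ] (y j * (a j i * x i))
          ≡⟨ sum-cong-≗ (λ j → sym (*-distribˡ-sum (y j) (λ i → a j i * x i))) ⟩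
        ∑[ j < n ] (y j * localField x j) ∎
        where
        open ≡-Reasoning
        commute : ∀ u v b → u * (b * v) ≡ v * (b * u)
        commute = solve-∀
        transpose : ∀ u v {b b′} → b ≡ b′ → u * (b * v) ≡ v * (b′ * u)
        transpose u v {b} refl = commute u v b

      energy-step : ∀ K x y z →
        energy K y z - energy K x y ≡ ∑[ i < n ] ((z i - x i) * (+ 2 * localField y i + K i))
      energy-step K x y z = begin
        energy K y z - energy K x y   ≡⟨ cong (λ e → energy K y z - e) swapped ⟩
        sum P - sum Q                 ≡⟨ sym (∑-distrib-minus P Q) ⟩
        ∑[ i < n ] (P i - Q i)        ≡⟨ sum-cong-≗ (λ i → expand (z i) (x i) (y i) (localField y i) (K i)) ⟩
        ∑[ i < n ] ((z i - x i) * (+ 2 * localField y i + K i)) ∎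
        where
        open ≡-Reasoning
        P Q : Vector ℤ n
        P i = + 2 * (z i * localField y i) + K i * (y i + z i)
        Q i = + 2 * (x i * localField y i) + K i * (x i + y i)
        expand : ∀ z x y F k →
          (+ 2 * (z * F) + k * (y + z)) - (+ 2 * (x * F) + k * (x + y)) ≡ (z - x) * (+ 2 * F + k)
        expand = solve-∀
        ∑2*+ : (f g : Vector ℤ n) → ∑[ i < n ] (+ 2 * f i + g i) ≡ + 2 * sum f + sum g
        ∑2*+ f g = trans (∑-distrib-+ _ g) (cong (_+ sum g) (sym (*-distribˡ-sum (+ 2) f)))
        swapped : energy K x y ≡ sum Q
        swapped = begin
          energy K x y
            ≡⟨ ∑2*+ _ _ ⟩
          + 2 * ∑[ i < n ] (y i * localField x i) + ∑[ i < n ] (K i * (x i + y i))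
            ≡⟨ cong (λ s → + 2 * s + _) (localField-sym y x) ⟩
          + 2 * ∑[ i < n ] (x i * localField y i) + ∑[ i < n ] (K i * (x i + y i))
            ≡⟨ sym (∑2*+ _ _) ⟩
          sum Q ∎

  ⟦_⟧ : Bool → ℤ
  ⟦ true  ⟧ = 1ℤ
  ⟦ false ⟧ = 0ℤ

  twice+slack-nonneg : ∀ {d s} → 0ℤ ≤ d → 0ℤ ≤ s → 0ℤ ≤ + 2 * d + s
  twice+slack-nonneg 0≤d 0≤s = +-mono-≤ (*-monoˡ-≤-nonNeg (+ 2) 0≤d) 0≤s

  twice+slack≡0 : ∀ {d s} → 0ℤ ≤ d → 0ℤ ≤ s → + 2 * d + s ≡ 0ℤ → d ≡ 0ℤ × s ≡ 0ℤ
  twice+slack≡0 {d} {s} 0≤d 0≤s eq = d≡0 , s≡0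
    where
    0≤2d : 0ℤ ≤ + 2 * d
    0≤2d = *-monoˡ-≤-nonNeg (+ 2) 0≤d
    d≡0 : d ≡ 0ℤ
    d≡0 with i*j≡0⇒i≡0∨j≡0 (+ 2) (nonneg+nonneg≡0⇒≡0 0≤2d 0≤s eq)
    ... | inj₁ ()
    ... | inj₂ d≡0 = d≡0
    s≡0 : s ≡ 0ℤ
    s≡0 = nonneg+nonneg≡0⇒≡0 0≤s 0≤2d (trans (+-comm s _) eq)

  riseSlack fallSlack : Bool → Bool → ℤ
  riseSlack b c = ⟦ b ⟧ + 1ℤ - + 2 * (⟦ b ⟧ * ⟦ c ⟧)
  fallSlack b c = 1ℤ + + 2 * (⟦ b ⟧ * ⟦ c ⟧) - ⟦ b ⟧

  riseSlack-nonneg : ∀ b c → 0ℤ ≤ riseSlack b c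
  riseSlack-nonneg true  true  = +≤+ z≤n
  riseSlack-nonneg true  false = +≤+ z≤n
  riseSlack-nonneg false c     = +≤+ z≤n

  fallSlack-nonneg : ∀ b c → 0ℤ ≤ fallSlack b c
  fallSlack-nonneg true  true  = +≤+ z≤n
  fallSlack-nonneg true  false = +≤+ z≤n
  fallSlack-nonneg false c     = +≤+ z≤n

  -- The vertex term of E(s+1) − E(s). It is nonnegative whatever v₁ does because the constant
  -- ⟦ b ⟧ + 1 absorbs the external input ⟦ b ⟧ * ⟦ c ⟧ ∈ {0, ⟦ b ⟧}.
  thresholdGain : (y₀ y₂ b : Bool) (g r : ℤ) → ℤ
  thresholdGain y₀ y₂ b g r = (⟦ y₂ ⟧ - ⟦ y₀ ⟧) * (+ 2 * g + (⟦ b ⟧ + 1ℤ - + 2 * r))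

  rise-decomposition : ∀ b c g r →
    thresholdGain false true b g r ≡ + 2 * (⟦ b ⟧ * ⟦ c ⟧ + g - r) + riseSlack b c
  rise-decomposition b c g r = identity ⟦ b ⟧ ⟦ c ⟧ g r
    where
    identity : ∀ B C g r →
      1ℤ * (+ 2 * g + (B + 1ℤ - + 2 * r)) ≡ + 2 * (B * C + g - r) + (B + 1ℤ - + 2 * (B * C))
    identity = solve-∀

  fall-decomposition : ∀ b c g r →
    thresholdGain true false b g r ≡ + 2 * (r - (1ℤ + (⟦ b ⟧ * ⟦ c ⟧ + g))) + fallSlack b c
  fall-decomposition b c g r = identity ⟦ b ⟧ ⟦ c ⟧ g r
    where
    identity : ∀ B C g r →
      -1ℤ * (+ 2 * g + (B + 1ℤ - + 2 * r)) ≡ + 2 * (r - (1ℤ + (B * C + g))) + (1ℤ + + 2 * (B * C) - B)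
    identity = solve-∀

  ≰⇒0≤i-[1+j] : ∀ {i j} → ¬ i ≤ j → 0ℤ ≤ i - (1ℤ + j)
  ≰⇒0≤i-[1+j] i≰j = i≤j⇒0≤j-i (i<j⇒suc[i]≤j (≰⇒> i≰j))

  Critical : Bool → ℤ → ℤ → Set
  Critical b g r = b ≡ true × r ≡ 1ℤ + g

  rise⇒critical : ∀ b c g r → r ≤ ⟦ b ⟧ * ⟦ c ⟧ + g → thresholdGain false true b g r ≡ 0ℤ →
                  Critical b g r × true ≡ c
  rise⇒critical b c g r r≤f gain≡0 =
    critical b c (twice+slack≡0 (i≤j⇒0≤j-i r≤f) (riseSlack-nonneg b c)
                                (trans (sym (rise-decomposition b c g r)) gain≡0))
    where
    critical : ∀ b c → (⟦ b ⟧ * ⟦ c ⟧ + g) - r ≡ 0ℤ × riseSlack b c ≡ 0ℤ →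
               Critical b g r × true ≡ c
    critical true  true  (excess≡0 , _) = (refl , sym (i-j≡0⇒i≡j _ _ excess≡0)) , refl
    critical true  false (_ , ())
    critical false _     (_ , ())

  fall⇒critical : ∀ b c g r → ¬ r ≤ ⟦ b ⟧ * ⟦ c ⟧ + g → thresholdGain true false b g r ≡ 0ℤ →
                  Critical b g r × false ≡ c
  fall⇒critical b c g r r≰f gain≡0 =
    critical b c (twice+slack≡0 (≰⇒0≤i-[1+j] r≰f) (fallSlack-nonneg b c)
                                (trans (sym (fall-decomposition b c g r)) gain≡0))
    where
    critical : ∀ b c → r - (1ℤ + (⟦ b ⟧ * ⟦ c ⟧ + g)) ≡ 0ℤ × fallSlack b c ≡ 0ℤ →
               Critical b g r × false ≡ c
    critical true  false (deficit≡0 , _) =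
      (refl , trans (i-j≡0⇒i≡j _ _ deficit≡0) (cong (_+_ 1ℤ) (+-identityˡ g))) , refl
    critical true  true  (_ , ())
    critical false _     (_ , ())

  record ThresholdRule (y b c : Bool) (g r : ℤ) : Set where
    field
      accept : y ≡ true → r ≤ ⟦ b ⟧ * ⟦ c ⟧ + g
      reject : y ≡ false → ¬ r ≤ ⟦ b ⟧ * ⟦ c ⟧ + g

  open ThresholdRule

  accepted : ∀ {y b c g r} → ThresholdRule y b c g r → r ≤ ⟦ b ⟧ * ⟦ c ⟧ + g → y ≡ true
  accepted {true}  rule r≤f = refl
  accepted {false} rule r≤f = ⊥-elim (reject rule refl r≤f)

  thresholdGain-nonneg : ∀ y₀ {y₂ b c g r} → ThresholdRule y₂ b c g r → 0ℤ ≤ thresholdGain y₀ y₂ b g r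
  thresholdGain-nonneg false {false} rule = ≤-refl
  thresholdGain-nonneg true  {true}  rule = ≤-refl
  thresholdGain-nonneg false {true}  {b} {c} {g} {r} rule =
    subst (0ℤ ≤_) (sym (rise-decomposition b c g r))
          (twice+slack-nonneg (i≤j⇒0≤j-i (accept rule refl)) (riseSlack-nonneg b c))
  thresholdGain-nonneg true  {false} {b} {c} {g} {r} rule =
    subst (0ℤ ≤_) (sym (fall-decomposition b c g r))
          (twice+slack-nonneg (≰⇒0≤i-[1+j] (reject rule refl)) (fallSlack-nonneg b c))

  thresholdGain≡0⇒critical : ∀ y₀ {y₂ b c g r} → ThresholdRule y₂ b c g r →
    thresholdGain y₀ y₂ b g r ≡ 0ℤ → y₂ ≢ y₀ → Critical b g r × y₂ ≡ c
  thresholdGain≡0⇒critical false {false} rule _ y₂≢y₀ = ⊥-elim (y₂≢y₀ refl)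
  thresholdGain≡0⇒critical true  {true}  rule _ y₂≢y₀ = ⊥-elim (y₂≢y₀ refl)
  thresholdGain≡0⇒critical false {true}  {b} {c} {g} {r} rule gain≡0 _ =
    rise⇒critical b c g r (accept rule refl) gain≡0
  thresholdGain≡0⇒critical true  {false} {b} {c} {g} {r} rule gain≡0 _ =
    fall⇒critical b c g r (reject rule refl) gain≡0

  ∣∩∣≡∑ : ∀ {m} (p q : Subset m) → + ∣ p ∩ q ∣ ≡ ∑[ j < m ] (⟦ lookup p j ⟧ * ⟦ lookup q j ⟧)
  ∣∩∣≡∑ []          []          = refl
  ∣∩∣≡∑ (true ∷ p)  (true ∷ q)  = cong (_+_ 1ℤ) (∣∩∣≡∑ p q)
  ∣∩∣≡∑ (true ∷ p)  (false ∷ q) = trans (∣∩∣≡∑ p q) (sym (+-identityˡ _))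
  ∣∩∣≡∑ (false ∷ p) (true ∷ q)  = trans (∣∩∣≡∑ p q) (sym (+-identityˡ _))
  ∣∩∣≡∑ (false ∷ p) (false ∷ q) = trans (∣∩∣≡∑ p q) (sym (+-identityˡ _))

  ⟦⟧*-mono : ∀ a {u v} → (u ≡ true → v ≡ true) → ⟦ a ⟧ * ⟦ u ⟧ ≤ ⟦ a ⟧ * ⟦ v ⟧
  ⟦⟧*-mono false                 _   = ≤-refl
  ⟦⟧*-mono true  {false} {false} _   = ≤-refl
  ⟦⟧*-mono true  {false} {true}  _   = +≤+ z≤n
  ⟦⟧*-mono true  {true}  {true}  _   = ≤-refl
  ⟦⟧*-mono true  {true}  {false} u⇒v with () ← u⇒v refl

  Symmetric⇒lookup-comm : ∀ {m} {N : Fin m → Subset m} → Symmetric N →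
                          ∀ i j → lookup (N i) j ≡ lookup (N j) i
  Symmetric⇒lookup-comm {N = N} symmetric i j with lookup (N i) j in eᵢⱼ | lookup (N j) i in eⱼᵢ
  ... | true  | true  = refl
  ... | false | false = refl
  ... | true  | false with () ← trans (sym eⱼᵢ) ([]=⇒lookup (symmetric i j (lookup⇒[]= j (N i) eᵢⱼ)))
  ... | false | true  with () ← trans (sym eᵢⱼ) ([]=⇒lookup (symmetric j i (lookup⇒[]= i (N j) eⱼᵢ)))

  tail-⊆ : ∀ {m} (X Y : Subset (suc m)) →
           (∀ i → lookup X (suc i) ≡ true → lookup Y (suc i) ≡ true) → tail X ⊆ tail Y
  tail-⊆ (_ ∷ X) (_ ∷ Y) X⇒Y {i} i∈X = lookup⇒[]= i Y (X⇒Y i ([]=⇒lookup i∈X))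

  module Dynamics {n : ℕ} (N : Fin (suc n) → Subset (suc n)) (r : Fin (suc n) → ℤ)
                  (U : ℕ → Subset (suc n)) (trajectory : IsTrajectory N r U) where

    step-deterministic : ∀ s t → U s ≡ U t → U (suc s) ≡ U (suc t)
    step-deterministic s t Us≡Ut = ⊆-antisym (follow s t Us≡Ut) (follow t s (sym Us≡Ut))
      where
      follow : ∀ s t → U s ≡ U t → U (suc s) ⊆ U (suc t)
      follow s t Us≡Ut {i} i∈ = Equivalence.from (trajectory t i)
        (subst (λ X → RuleHolds N r X i) Us≡Ut (Equivalence.to (trajectory s i) i∈))

    recurrent⇒periodic : ∀ p → U p ≡ U 0 → ∀ t → U (p ℕ.+ t) ≡ U t
    recurrent⇒periodic p Up≡U0 zero    = trans (cong U (ℕ.+-identityʳ p)) Up≡U0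
    recurrent⇒periodic p Up≡U0 (suc t) =
      trans (cong U (ℕ.+-suc p t)) (step-deterministic _ _ (recurrent⇒periodic p Up≡U0 t))

    opinion : ℕ → Fin n → Bool
    opinion s i = lookup (U s) (suc i)

    linked : Fin n → Bool
    linked i = lookup (N (suc i)) zero

    adj : Fin n → Fin n → ℤ
    adj i j = ⟦ lookup (N (suc i)) (suc j) ⟧

    indicator : Subset (suc n) → Vector ℤ n
    indicator X j = ⟦ lookup X (suc j) ⟧

    open Energy adj

    inflow : ℕ → Fin n → ℤ
    inflow s = localField (indicator (U s))

    neighbour-count : ∀ s i → + ∣ N (suc i) ∩ U s ∣ ≡ ⟦ linked i ⟧ * ⟦ c U s ⟧ + inflow s i
    neighbour-count s i = ∣∩∣≡∑ (N (suc i)) (U s)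

    threshold-rule : ∀ s i →
      ThresholdRule (opinion (suc s) i) (linked i) (c U s) (inflow s i) (r (suc i))
    accept (threshold-rule s i) on = subst (r (suc i) ≤_) (neighbour-count s i)
      (Equivalence.to (trajectory s (suc i)) (lookup⇒[]= (suc i) (U (suc s)) on))
    reject (threshold-rule s i) off r≤f with () ← trans (sym off) ([]=⇒lookup
      (Equivalence.from (trajectory s (suc i)) (subst (r (suc i) ≤_) (sym (neighbour-count s i)) r≤f)))

    inflow-mono : ∀ {s t} → (∀ j → opinion s j ≡ true → opinion t j ≡ true) →
                  ∀ i → inflow s i ≤ inflow t i
    inflow-mono s⇒t i = ∑-mono-≤ (λ j → ⟦⟧*-mono (lookup (N (suc i)) (suc j)) (s⇒t j))

    module _ (symmetric : Symmetric N) where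

      adj-sym : ∀ i j → adj i j ≡ adj j i
      adj-sym i j = cong ⟦_⟧ (Symmetric⇒lookup-comm symmetric (suc i) (suc j))

      bias : Vector ℤ n
      bias i = ⟦ linked i ⟧ + 1ℤ - + 2 * r (suc i)

      energyOf : Subset (suc n) → Subset (suc n) → ℤ
      energyOf X Y = energy bias (indicator X) (indicator Y)

      E : ℕ → ℤ
      E s = energyOf (U s) (U (suc s))

      gain : ℕ → Fin n → ℤ
      gain s i = thresholdGain (opinion s i) (opinion (2 ℕ.+ s) i) (linked i) (inflow (suc s) i) (r (suc i))

      gain-nonneg : ∀ s i → 0ℤ ≤ gain s i
      gain-nonneg s i = thresholdGain-nonneg (opinion s i) (threshold-rule (suc s) i)

      E-step : ∀ s → E (suc s) - E s ≡ ∑[ i < n ] gain s i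
      E-step s = energy-step adj-sym bias (indicator (U s)) (indicator (U (suc s)))
                                          (indicator (U (2 ℕ.+ s)))

      E-increasing : ∀ s → E s ≤ E (suc s)
      E-increasing s = 0≤i-j⇒j≤i (subst (0ℤ ≤_) (sym (E-step s)) (∑-nonneg (gain-nonneg s)))

      module Recurrence (p : ℕ) (recurrent : U (suc p) ≡ U 0) where

        E-periodic : ∀ t → E (suc p ℕ.+ t) ≡ E t
        E-periodic t = cong₂ energyOf (periodic t)
                                      (trans (cong U (sym (ℕ.+-suc (suc p) t))) (periodic (suc t)))
          where
          periodic : ∀ t → U (suc p ℕ.+ t) ≡ U t
          periodic = recurrent⇒periodic (suc p) recurrent

        gain≡0 : ∀ s i → gain s i ≡ 0ℤ
        gain≡0 s = ∑-nonneg≡0⇒≡0 (gain-nonneg s) (trans (sym (E-step s)) (i≡j⇒i-j≡0 E[1+s]≡E[s]))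
          where
          E[1+s]≡E[s] : E (suc s) ≡ E s
          E[1+s]≡E[s] = increasing∧periodic⇒stationary ≤-poset E p E-increasing E-periodic s

        flip⇒critical×follows : ∀ s i → opinion (2 ℕ.+ s) i ≢ opinion s i →
          Critical (linked i) (inflow (suc s) i) (r (suc i)) × opinion (2 ℕ.+ s) i ≡ c U (suc s)
        flip⇒critical×follows s i =
          thresholdGain≡0⇒critical (opinion s i) (threshold-rule (suc s) i) (gain≡0 s i)

        flip⇒critical : ∀ s i → opinion (2 ℕ.+ s) i ≢ opinion s i →
                        Critical (linked i) (inflow (suc s) i) (r (suc i))
        flip⇒critical s i flipped = proj₁ (flip⇒critical×follows s i flipped)

        flip⇒follows : ∀ s i → opinion (2 ℕ.+ s) i ≢ opinion s i → opinion (2 ℕ.+ s) i ≡ c U (suc s)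
        flip⇒follows s i flipped = proj₂ (flip⇒critical×follows s i flipped)

        two-step-⊆ : ∀ s → c U (suc s) ≡ true →
                     ∀ j → opinion s j ≡ true → opinion (2 ℕ.+ s) j ≡ true
        two-step-⊆ s c≡true j on with opinion (2 ℕ.+ s) j ≟ opinion s j
        ... | yes same    = trans same on
        ... | no  flipped = trans (flip⇒follows s j flipped) c≡true

        two-step-⊇ : ∀ s → c U (suc s) ≡ false →
                     ∀ j → opinion (2 ℕ.+ s) j ≡ true → opinion s j ≡ true
        two-step-⊇ s c≡false j on with opinion (2 ℕ.+ s) j ≟ opinion s j
        ... | yes same    = trans (sym same) on
        ... | no  flipped =
          contradiction (trans (sym on) (trans (flip⇒follows s j flipped) c≡false)) λ ()

        critical-rises : ∀ t i → Critical (linked i) (inflow (1 ℕ.+ t) i) (r (suc i)) →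
                         c U (2 ℕ.+ t) ≡ true → c U (3 ℕ.+ t) ≡ true → opinion (4 ℕ.+ t) i ≡ true
        critical-rises t i (linked≡true , r≡1+inflow) c₂ c₃ =
          accepted (threshold-rule (3 ℕ.+ t) i) (begin
            r (suc i)
              ≡⟨ r≡1+inflow ⟩
            1ℤ + inflow (1 ℕ.+ t) i
              ≤⟨ +-monoʳ-≤ 1ℤ (inflow-mono (two-step-⊆ (1 ℕ.+ t) c₂) i) ⟩
            1ℤ + inflow (3 ℕ.+ t) i
              ≡⟨ cong₂ (λ b c → ⟦ b ⟧ * ⟦ c ⟧ + inflow (3 ℕ.+ t) i) (sym linked≡true) (sym c₃) ⟩
            ⟦ linked i ⟧ * ⟦ c U (3 ℕ.+ t) ⟧ + inflow (3 ℕ.+ t) i ∎)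
          where open ≤-Reasoning

        critical-falls : ∀ t i → Critical (linked i) (inflow (1 ℕ.+ t) i) (r (suc i)) →
                         c U (2 ℕ.+ t) ≡ false → c U (3 ℕ.+ t) ≡ false → opinion (4 ℕ.+ t) i ≢ true
        critical-falls t i (linked≡true , r≡1+inflow) c₂ c₃ on₄ =
          <-irrefl refl (suc[i]≤j⇒i<j (begin
            1ℤ + inflow (1 ℕ.+ t) i
              ≡⟨ sym r≡1+inflow ⟩
            r (suc i)
              ≤⟨ accept (threshold-rule (3 ℕ.+ t) i) on₄ ⟩
            ⟦ linked i ⟧ * ⟦ c U (3 ℕ.+ t) ⟧ + inflow (3 ℕ.+ t) i
              ≡⟨ cong₂ (λ b c → ⟦ b ⟧ * ⟦ c ⟧ + inflow (3 ℕ.+ t) i) linked≡true c₃ ⟩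
            0ℤ + inflow (3 ℕ.+ t) i
              ≡⟨ +-identityˡ _ ⟩
            inflow (3 ℕ.+ t) i
              ≤⟨ inflow-mono (two-step-⊇ (1 ℕ.+ t) c₂) i ⟩
            inflow (1 ℕ.+ t) i ∎))
          where open ≤-Reasoning

        four-step-⊆ : ∀ t → c U (2 ℕ.+ t) ≡ true → c U (3 ℕ.+ t) ≡ true →
                      ∀ i → opinion t i ≡ true → opinion (4 ℕ.+ t) i ≡ true
        four-step-⊆ t c₂ c₃ i onₜ with opinion (2 ℕ.+ t) i ≟ opinion t i
        ... | yes same    = two-step-⊆ (2 ℕ.+ t) c₃ i (trans same onₜ)
        ... | no  flipped = critical-rises t i (flip⇒critical t i flipped) c₂ c₃

        four-step-⊇ : ∀ t → c U (2 ℕ.+ t) ≡ false → c U (3 ℕ.+ t) ≡ false →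
                      ∀ i → opinion (4 ℕ.+ t) i ≡ true → opinion t i ≡ true
        four-step-⊇ t c₂ c₃ i on₄ with opinion (2 ℕ.+ t) i ≟ opinion t i
        ... | yes same    = trans (sym same) (two-step-⊇ (2 ℕ.+ t) c₃ i on₄)
        ... | no  flipped = ⊥-elim (critical-falls t i (flip⇒critical t i flipped) c₂ c₃ on₄)

open EnergyMethod
open import Data.Nat using (_+_)

lemma6 : (n : ℕ) (N : Fin (suc n) → Subset (suc n)) (r : Fin (suc n) → ℤ)
         (U : ℕ → Subset (suc n)) →
         Symmetric N →
         IsTrajectory N r U →
         Σ ℕ (λ p → (p ≥ 1) × (U p ≡ U 0)) →
         (x : Bool) (t : ℕ) →
         c U (t + 1) ≡ not x → c U (t + 2) ≡ x → c U (t + 3) ≡ x →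
         (x ≡ true → U* U t ⊆ U* U (t + 4)) × (x ≡ false → U* U t ⊇ U* U (t + 4))
lemma6 n N r U symmetric trajectory (suc p , _ , recurrent) x t _ cₜ₊₂ cₜ₊₃ rewrite ℕ.+-comm t 4 =
  (λ x≡true  → tail-⊆ (U t) (U (4 + t)) (four-step-⊆ t (at 2 cₜ₊₂ x≡true)  (at 3 cₜ₊₃ x≡true))) ,
  (λ x≡false → tail-⊆ (U (4 + t)) (U t) (four-step-⊇ t (at 2 cₜ₊₂ x≡false) (at 3 cₜ₊₃ x≡false)))
  where
  open Dynamics N r U trajectory
  open Recurrence symmetric p recurrent
  at : ∀ k {b} → c U (t + k) ≡ x → x ≡ b → c U (k ℕ.+ t) ≡ b
  at k cₜ₊ₖ x≡b = trans (subst (λ s → c U s ≡ x) (ℕ.+-comm t k) cₜ₊ₖ) x≡b
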